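{- For any integers $s>r\ge 2$ and any $k>r2^r$ we have $r_k(K_s^{r})> t_{r}\left(\frac{k}{2^r}\right)$.
   Context: $K_s^r$ is the complete $r$-uniform hypergraph on $s$ vertices. $r_k(H)$ is the minimum $n$ such that every $k$-coloring of the edges of $K_n^r$ contains a monochromatic copy of $H$. The tower function is defined by $t_1(x)=x$ and $t_{i+1}(x)=2^{t_i(x)}$ for $i\ge 1$. -}

module Defs where

open import Data.Nat using (ℕ; zero; suc; _+_; _*_; _∸_; _^_; _≤_; _<_)
open import Data.Fin using (Fin)
open import Data.Fin.Subset using (Subset; _⊆_; ∣_∣)
open import Data.Product using (Σ; _×_; ∃; ∃-syntax)
open import Relation.Binary.PropositionalEquality using (_≡_)

-- The vertex set of K_n^r is Fin n; edges are the r-element subsets.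
-- A k-colouring of the edges is a map Subset n → Fin k (only its values
-- on r-element subsets matter).

MonoClique : ∀ {n k} (r s : ℕ) → (Subset n → Fin k) → Set
MonoClique {n} {k} r s χ =
  Σ (Subset n) λ S → Σ (Fin k) λ c →
    (∣ S ∣ ≡ s) × (∀ (e : Subset n) → e ⊆ S → ∣ e ∣ ≡ r → χ e ≡ c)

-- "K_n^r → (K_s^r)_k": every k-colouring of K_n^r has a monochromatic K_s^r.
-- r_k(K_s^r) is the least n with Arrows n k r s.
Arrows : (n k r s : ℕ) → Set
Arrows n k r s = ∀ (χ : Subset n → Fin k) → MonoClique r s χ

-- Tower function t_1(x) = x, t_{i+1}(x) = 2^{t_i(x)} evaluated at a
-- positive rational x = a/b, without real numbers.
--
-- RatBelowTower i a b c d  means   c/d < t_{i+1}(a/b)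
-- (for b ≥ 1, d ≥ 1, a ≥ 1), defined by:
--   c/d < t_1(a/b)         iff  c*b < a*d
--   c/d < 2^{t_{i+1}(a/b)} iff  ∃ rational e/f ≥ 0 (f ≥ 1) with
--                               c/d < 2^{e/f}   (i.e. c^f < 2^e * d^f)
--                           and e/f < t_{i+1}(a/b).
-- (valid since t_{i+1}(a/b) > 0 and by density of the rationals.)

RatBelowTower : (i a b c d : ℕ) → Set
RatBelowTower zero    a b c d = c * b < a * d
RatBelowTower (suc i) a b c d =
  ∃[ e ] ∃[ f ] (1 ≤ f × c ^ f < 2 ^ e * d ^ f × RatBelowTower i a b e f)

-- N ≤ t_i(a/b)  (for i ≥ 1) iff every nonnegative rational c/d < N
-- satisfies c/d < t_i(a/b).
NatLeTower : (i a b N : ℕ) → Set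
NatLeTower i a b N =
  ∀ (c d : ℕ) → 1 ≤ d → c < N * d → RatBelowTower (i ∸ 1) a b c d

module Submission where

-- r_k(K_s^r) > t_r(k / 2^r), by iterating the Erdős–Hajnal stepping-up lemma.
--
-- Sets of numbers are handled as increasing lists.  For every m and ℓ we build a
-- colouring of the (ℓ+1)-subsets of {0, …, t_{ℓ+1}(m) - 1} with at most
-- 2^ℓ (m + ℓ) colours in which no (ℓ+2)-set has all its (ℓ+1)-subsets of one
-- colour.  Level 0 colours each vertex by itself.  Level ℓ+1 steps up from level
-- ℓ: for x₀ < … < x_n below 2^F let δᵢ be the most significant binary digit in
-- which xᵢ and xᵢ₊₁ differ; consecutive δᵢ differ, and δ(x, z) = max(δ(x, y), δ(y, z)).
-- A list is coloured by the old colour of (δᵢ) when it increases, by a shifted old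
-- colour of its mirror image when it decreases, and by its up/down pattern otherwise.

open import Defs
open import Data.Nat using (ℕ; zero; suc; _+_; _*_; _∸_; _^_; _⊔_; _≤_; _<_; _>_; z≤n; s≤s; z<s; _<ᵇ_; NonZero)
open import Data.Nat.Properties
open import Data.Nat.DivMod using (_/_; _%_; m≡m%n+[m/n]*n; m%n<n; m/n*n≤m)
open import Data.Nat.Tactic.RingSolver using (solve-∀)
open import Data.Bool using (Bool; true; false; T)
open import Data.Unit using (tt)
open import Data.List using (List; []; _∷_; length; map)
open import Data.List.Properties using (length-map; ∷-injective)
open import Data.List.Relation.Unary.All using (All; []; _∷_)
import Data.List.Relation.Unary.All as All
open import Data.List.Relation.Unary.All.Properties using () renaming (map⁺ to All-map⁺)
open import Data.List.Relation.Unary.Linked using (Linked; []; [-]; _∷_; linked?)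
import Data.List.Relation.Unary.Linked as Linked
open import Data.List.Relation.Unary.Linked.Properties using () renaming (map⁺ to Linked-map⁺)
open import Data.Fin using (Fin; toℕ; fromℕ<)
open import Data.Fin.Properties using (toℕ-fromℕ<)
open import Data.Fin.Subset using (Subset; _⊆_; ∣_∣; inside; outside)
open import Data.Fin.Subset.Properties using (⊆-refl; ⊆-trans; out⊆; s⊆s)
open import Data.Vec using ([]; _∷_)
open import Data.Empty using (⊥; ⊥-elim)
open import Data.Sum using (_⊎_; inj₁; inj₂)
open import Data.Product using (_×_; _,_; proj₁; proj₂; uncurry; ∃-syntax)
open import Relation.Nullary using (¬_; yes; no)
open import Relation.Binary.PropositionalEquality

private
  variable
    A B : Set

adjacent : (A → A → B) → List A → List B
adjacent f (x ∷ y ∷ xs) = f x y ∷ adjacent f (y ∷ xs)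
adjacent f _            = []

-- Remove the entry at position i (counting from 0); out of range, nothing happens.
deleteAt : ℕ → List A → List A
deleteAt _       []       = []
deleteAt zero    (x ∷ xs) = xs
deleteAt (suc i) (x ∷ xs) = x ∷ deleteAt i xs

dropLast : List A → List A
dropLast []           = []
dropLast (x ∷ [])     = []
dropLast (x ∷ y ∷ xs) = x ∷ dropLast (y ∷ xs)

length-adjacent : (f : A → A → B) (xs : List A) → length (adjacent f xs) ≡ length xs ∸ 1
length-adjacent f []           = refl
length-adjacent f (x ∷ [])     = refl
length-adjacent f (x ∷ y ∷ xs) = cong suc (length-adjacent f (y ∷ xs))

length-deleteAt : ∀ i (xs : List A) → i < length xs → length (deleteAt i xs) ≡ length xs ∸ 1
length-deleteAt zero    (x ∷ xs)     _          = refl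
length-deleteAt (suc i) (x ∷ y ∷ xs) (s≤s i<n) = cong suc (length-deleteAt i (y ∷ xs) i<n)

deleteAt-last : ∀ i (xs : List A) → length xs ≡ suc i → deleteAt i xs ≡ dropLast xs
deleteAt-last zero    (x ∷ [])     _   = refl
deleteAt-last (suc i) (x ∷ y ∷ xs) len = cong (x ∷_) (deleteAt-last i (y ∷ xs) (suc-injective len))

deleteAt-map : (f : A → B) (i : ℕ) (xs : List A) → deleteAt i (map f xs) ≡ map f (deleteAt i xs)
deleteAt-map f _       []       = refl
deleteAt-map f zero    (x ∷ xs) = refl
deleteAt-map f (suc i) (x ∷ xs) = cong (f x ∷_) (deleteAt-map f i xs)

adjacent-deleteHead : (f : A → A → B) (xs : List A) → adjacent f (deleteAt 0 xs) ≡ deleteAt 0 (adjacent f xs)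
adjacent-deleteHead f []           = refl
adjacent-deleteHead f (x ∷ [])     = refl
adjacent-deleteHead f (x ∷ y ∷ xs) = refl

adjacent-dropLast : (f : A → A → B) (xs : List A) → adjacent f (dropLast xs) ≡ dropLast (adjacent f xs)
adjacent-dropLast f []               = refl
adjacent-dropLast f (x ∷ [])         = refl
adjacent-dropLast f (x ∷ y ∷ [])     = refl
adjacent-dropLast f (x ∷ y ∷ z ∷ xs) = cong (f x y ∷_) (adjacent-dropLast f (y ∷ z ∷ xs))

All-deleteAt : {P : A → Set} (i : ℕ) {xs : List A} → All P xs → All P (deleteAt i xs)
All-deleteAt _       []         = []
All-deleteAt zero    (px ∷ pxs) = pxs
All-deleteAt (suc i) (px ∷ pxs) = px ∷ All-deleteAt i pxs

Linked-deleteAt : {R : A → A → Set} → (∀ {x y z} → R x y → R y z → R x z) →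
                  ∀ i {xs : List A} → Linked R xs → Linked R (deleteAt i xs)
Linked-deleteAt trans i             []                = []
Linked-deleteAt trans zero          [-]               = []
Linked-deleteAt trans (suc i)       [-]               = [-]
Linked-deleteAt trans zero          (_ ∷ rs)          = rs
Linked-deleteAt trans (suc zero)    (_ ∷ [-])         = [-]
Linked-deleteAt trans (suc zero)    (r ∷ r′ ∷ rs)     = trans r r′ ∷ rs
Linked-deleteAt trans (suc (suc i)) (r ∷ rs)          = r ∷ Linked-deleteAt trans (suc i) rs

Linked-join : {R : A → A → Set} (xs : List A) → 3 ≤ length xs →
              Linked R (deleteAt 0 xs) → Linked R (dropLast xs) → Linked R xs
Linked-join (x ∷ y ∷ z ∷ xs) _ tail-linked init-linked = Linked.head init-linked ∷ tail-linked
Linked-join (x ∷ [])         (s≤s ())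
Linked-join (x ∷ y ∷ [])     (s≤s (s≤s ()))

adjacent⇒Linked : {P : B → Set} {R : A → A → Set} (f : A → A → B) →
                  (∀ {x y} → P (f x y) → R x y) → (xs : List A) → All P (adjacent f xs) → Linked R xs
adjacent⇒Linked f test []           _          = []
adjacent⇒Linked f test (x ∷ [])     _          = [-]
adjacent⇒Linked f test (x ∷ y ∷ xs) (p ∷ ps) = test p ∷ adjacent⇒Linked f test (y ∷ xs) ps

shift-invariant⇒constant : (b : A) (q : List A) → q ≡ dropLast (b ∷ q) → All (_≡ b) q
shift-invariant⇒constant b []      _  = []
shift-invariant⇒constant b (c ∷ q) eq with ∷-injective eq
... | refl , eq′ = refl ∷ shift-invariant⇒constant b q eq′

-- An n-subset of {0, …, F-1}, represented by the increasing list of its elements.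
record Edge (F n : ℕ) (xs : List ℕ) : Set where
  constructor edge
  field
    increasing : Linked _<_ xs
    size       : length xs ≡ n
    bounded    : All (_< F) xs

Bounded : (K F n : ℕ) → (List ℕ → ℕ) → Set
Bounded K F n φ = ∀ {xs} → Edge F n xs → φ xs < K

NoMonochromatic : (F n : ℕ) → (List ℕ → ℕ) → Set
NoMonochromatic F n φ =
  ∀ {xs} → Edge F (suc n) xs → ∀ c → ¬ (∀ i → i ≤ n → φ (deleteAt i xs) ≡ c)

edge-deleteAt : ∀ {F n xs} → Edge F (suc n) xs → ∀ i → i ≤ n → Edge F n (deleteAt i xs)
edge-deleteAt {xs = xs} (edge inc size bnd) i i≤n = edge
  (Linked-deleteAt <-trans i inc)
  (trans (length-deleteAt i xs (subst (i <_) (sym size) (s≤s i≤n))) (cong (_∸ 1) size))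
  (All-deleteAt i bnd)

-- The branching digit: for x ≠ y below 2^F, δ F x y is the most significant
-- binary digit in which x and y differ.
δ : ℕ → ℕ → ℕ → ℕ
δ zero    x y = 0
δ (suc F) x y with x <? 2 ^ F | y <? 2 ^ F
... | yes _ | yes _ = δ F x y
... | no _  | no _  = δ F (x ∸ 2 ^ F) (y ∸ 2 ^ F)
... | _     | _     = F

upper-half : ∀ F {x} → 2 ^ F ≤ x → x < 2 ^ suc F → x ∸ 2 ^ F < 2 ^ F
upper-half F {x} 2^F≤x x<2^F+1 = +-cancelˡ-< (2 ^ F) (x ∸ 2 ^ F) (2 ^ F)
  (subst₂ _<_ (sym (m+[n∸m]≡n 2^F≤x)) (cong (2 ^ F +_) (+-identityʳ (2 ^ F))) x<2^F+1)

shift-down : ∀ F {x y} → 2 ^ F ≤ x → x < y → y < 2 ^ suc F →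
             x ∸ 2 ^ F < y ∸ 2 ^ F × y ∸ 2 ^ F < 2 ^ F
shift-down F 2^F≤x x<y y<2^F+1 =
  ∸-monoˡ-< x<y 2^F≤x , upper-half F (≤-trans 2^F≤x (<⇒≤ x<y)) y<2^F+1

shift-down₃ : ∀ F {x y z} → 2 ^ F ≤ x → x < y → y < z → z < 2 ^ suc F →
              x ∸ 2 ^ F < y ∸ 2 ^ F × y ∸ 2 ^ F < z ∸ 2 ^ F × z ∸ 2 ^ F < 2 ^ F
shift-down₃ F 2^F≤x x<y y<z z<2^F+1 =
  ∸-monoˡ-< x<y 2^F≤x , shift-down F (≤-trans 2^F≤x (<⇒≤ x<y)) y<z z<2^F+1

δ-bound : ∀ F {x y} → x < y → y < 2 ^ F → δ F x y < F
δ-bound zero    {x} {y} x<y y<1 = ⊥-elim (<-irrefl refl (≤-<-trans z≤n (<-≤-trans x<y (≤-pred y<1))))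
δ-bound (suc F) {x} {y} x<y y<2^F+1 with x <? 2 ^ F | y <? 2 ^ F
... | yes _    | yes y<  = m<n⇒m<1+n (δ-bound F x<y y<)
... | yes _    | no _    = n<1+n F
... | no x≮    | yes y<  = ⊥-elim (x≮ (<-trans x<y y<))
... | no x≮    | no _    = m<n⇒m<1+n (uncurry (δ-bound F) (shift-down F (≮⇒≥ x≮) x<y y<2^F+1))

δ-distinct : ∀ F {x y z} → x < y → y < z → z < 2 ^ F → δ F x y ≢ δ F y z
δ-distinct zero    x<y y<z z<1 = ⊥-elim (<-irrefl refl (≤-<-trans z≤n (<-≤-trans (<-trans x<y y<z) (≤-pred z<1))))
δ-distinct (suc F) {x} {y} {z} x<y y<z z<2^F+1 with x <? 2 ^ F | y <? 2 ^ F | z <? 2 ^ F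
... | yes _  | yes _  | yes z<  = δ-distinct F x<y y<z z<
... | yes _  | yes y< | no _    = <⇒≢ (δ-bound F x<y y<)
... | yes _  | no y≮  | no _    = λ eq → <⇒≢ (uncurry (δ-bound F) (shift-down F (≮⇒≥ y≮) y<z z<2^F+1)) (sym eq)
... | _      | no y≮  | yes z<  = ⊥-elim (y≮ (<-trans y<z z<))
... | no x≮  | yes y< | _       = ⊥-elim (x≮ (<-trans x<y y<))
... | no x≮  | no _   | no _    with shift-down₃ F (≮⇒≥ x≮) x<y y<z z<2^F+1
...   | x′<y′ , y′<z′ , z′< = δ-distinct F x′<y′ y′<z′ z′<

δ-merge : ∀ F {x y z} → x < y → y < z → z < 2 ^ F → δ F x z ≡ δ F x y ⊔ δ F y z
δ-merge zero    x<y y<z z<1 = refl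
δ-merge (suc F) {x} {y} {z} x<y y<z z<2^F+1 with x <? 2 ^ F | y <? 2 ^ F | z <? 2 ^ F
... | yes _  | yes _  | yes z<  = δ-merge F x<y y<z z<
... | yes _  | yes y< | no _    = sym (m≤n⇒m⊔n≡n (<⇒≤ (δ-bound F x<y y<)))
... | yes _  | no y≮  | no _    = sym (m≥n⇒m⊔n≡m (<⇒≤ (uncurry (δ-bound F) (shift-down F (≮⇒≥ y≮) y<z z<2^F+1))))
... | _      | no y≮  | yes z<  = ⊥-elim (y≮ (<-trans y<z z<))
... | no x≮  | yes y< | _       = ⊥-elim (x≮ (<-trans x<y y<))
... | no x≮  | no _   | no _    with shift-down₃ F (≮⇒≥ x≮) x<y y<z z<2^F+1
...   | x′<y′ , y′<z′ , z′< = δ-merge F x′<y′ y′<z′ z′<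

δs : ℕ → List ℕ → List ℕ
δs F = adjacent (δ F)

length-δs : ∀ F {n} (xs : List ℕ) → length xs ≡ suc n → length (δs F xs) ≡ n
length-δs F xs size = trans (length-adjacent (δ F) xs) (cong (_∸ 1) size)

δs-bounded : ∀ F {xs} → Linked _<_ xs → All (_< 2 ^ F) xs → All (_< F) (δs F xs)
δs-bounded F []           _                      = []
δs-bounded F [-]          _                      = []
δs-bounded F (x<y ∷ rest) (_ ∷ bnd@(y<2^F ∷ _)) = δ-bound F x<y y<2^F ∷ δs-bounded F rest bnd

δs-distinct : ∀ F {xs} → Linked _<_ xs → All (_< 2 ^ F) xs → Linked _≢_ (δs F xs)
δs-distinct F []                     _                          = []
δs-distinct F [-]                    _                          = []
δs-distinct F (_ ∷ [-])              _                          = [-]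
δs-distinct F (x<y ∷ rest@(y<z ∷ _)) (_ ∷ bnd@(_ ∷ z<2^F ∷ _)) =
  δ-distinct F x<y y<z z<2^F ∷ δs-distinct F rest bnd

-- If the branching digits increase, deleting x_{j+1} deletes δ_j:
-- the merged digit δ(x_j, x_{j+2}) = max(δ_j, δ_{j+1}) is δ_{j+1}.
δs-deleteAt-rising : ∀ F j (xs : List ℕ) → Linked _<_ xs → All (_< 2 ^ F) xs → Linked _<_ (δs F xs) →
                     δs F (deleteAt (suc j) xs) ≡ deleteAt j (δs F xs)
δs-deleteAt-rising F j       []               _ _ _ = refl
δs-deleteAt-rising F j       (x ∷ [])         _ _ _ = refl
δs-deleteAt-rising F zero    (x ∷ y ∷ [])     _ _ _ = refl
δs-deleteAt-rising F zero    (x ∷ y ∷ z ∷ xs) (x<y ∷ y<z ∷ _) (_ ∷ _ ∷ z<2^F ∷ _) (δxy<δyz ∷ _) =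
  cong (_∷ δs F (z ∷ xs)) (trans (δ-merge F x<y y<z z<2^F) (m≤n⇒m⊔n≡n (<⇒≤ δxy<δyz)))
δs-deleteAt-rising F (suc j) (x ∷ y ∷ xs)     inc (_ ∷ bnd) rising =
  cong (δ F x y ∷_) (δs-deleteAt-rising F j (y ∷ xs) (Linked.tail inc) bnd (Linked.tail rising))

-- If they decrease, deleting x_i (i not last) deletes δ_i: the merged digit is δ_{i-1}.
δs-deleteAt-falling : ∀ F i (xs : List ℕ) → suc i < length xs →
                      Linked _<_ xs → All (_< 2 ^ F) xs → Linked _>_ (δs F xs) →
                      δs F (deleteAt i xs) ≡ deleteAt i (δs F xs)
δs-deleteAt-falling F zero xs _ _ _ _ = adjacent-deleteHead (δ F) xs
δs-deleteAt-falling F (suc zero) (x ∷ y ∷ z ∷ xs) _ (x<y ∷ y<z ∷ _) (_ ∷ _ ∷ z<2^F ∷ _) (δxy>δyz ∷ _) =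
  cong (_∷ δs F (z ∷ xs)) (trans (δ-merge F x<y y<z z<2^F) (m≥n⇒m⊔n≡m (<⇒≤ δxy>δyz)))
δs-deleteAt-falling F (suc (suc i)) (x ∷ y ∷ z ∷ xs) (s≤s i<) inc (_ ∷ bnd) falling =
  cong (δ F x y ∷_) (δs-deleteAt-falling F (suc i) (y ∷ z ∷ xs) i< (Linked.tail inc) bnd (Linked.tail falling))
δs-deleteAt-falling F (suc i)       (x ∷ [])     (s≤s ())
δs-deleteAt-falling F (suc zero)    (x ∷ y ∷ []) (s≤s (s≤s ()))
δs-deleteAt-falling F (suc (suc i)) (x ∷ y ∷ []) (s≤s (s≤s ()))

upDown : List ℕ → List Bool
upDown = adjacent _<ᵇ_

ascent : ∀ {x y} → (x <ᵇ y) ≡ true → x < y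
ascent {x} {y} eq = <ᵇ⇒< x y (subst T (sym eq) tt)

non-ascent : ∀ {x y} → (x <ᵇ y) ≡ false → y ≤ x
non-ascent eq = ≮⇒≥ (λ x<y → subst T eq (<⇒<ᵇ x<y))

rising-pattern : (xs : List ℕ) → All (_≡ true) (upDown xs) → Linked _<_ xs
rising-pattern = adjacent⇒Linked _<ᵇ_ ascent

falling-pattern : (xs : List ℕ) → All (_≡ false) (upDown xs) → Linked _≢_ xs → Linked _>_ xs
falling-pattern xs downs distinct =
  Linked.zipWith (λ (y≤x , x≢y) → ≤∧≢⇒< y≤x (≢-sym x≢y)) (adjacent⇒Linked _<ᵇ_ non-ascent xs downs , distinct)

code : List Bool → ℕ
code []          = 0
code (true ∷ p)  = 2 ^ length p + code p
code (false ∷ p) = code p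

code-bound : ∀ p → code p < 2 ^ length p
code-bound []          = s≤s z≤n
code-bound (true ∷ p)  = subst (2 ^ length p + code p <_) (cong (2 ^ length p +_) (sym (+-identityʳ _)))
                               (+-monoʳ-< (2 ^ length p) (code-bound p))
code-bound (false ∷ p) = <-≤-trans (code-bound p) (m≤m+n (2 ^ length p) _)

code-injective : ∀ p q → length p ≡ length q → code p ≡ code q → p ≡ q
code-injective []          []          _   _  = refl
code-injective (true ∷ p)  (true ∷ q)  len eq =
  cong (true ∷_) (code-injective p q (suc-injective len)
    (+-cancelˡ-≡ (2 ^ length p) _ _ (trans eq (cong (λ l → 2 ^ l + code q) (sym (suc-injective len))))))
code-injective (false ∷ p) (false ∷ q) len eq = cong (false ∷_) (code-injective p q (suc-injective len) eq)
code-injective (true ∷ p)  (false ∷ q) len eq =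
  ⊥-elim (<⇒≱ (code-bound q) (subst₂ _≤_ (cong (2 ^_) (suc-injective len)) eq (m≤m+n _ _)))
code-injective (false ∷ p) (true ∷ q)  len eq =
  ⊥-elim (<⇒≱ (code-bound p) (subst₂ _≤_ (cong (2 ^_) (sym (suc-injective len))) (sym eq) (m≤m+n _ _)))

shift-invariant-bits : (p : List Bool) → deleteAt 0 p ≡ dropLast p →
                       All (_≡ true) (deleteAt 0 p) ⊎ All (_≡ false) (deleteAt 0 p)
shift-invariant-bits []          _  = inj₁ []
shift-invariant-bits (true ∷ q)  eq = inj₁ (shift-invariant⇒constant true q eq)
shift-invariant-bits (false ∷ q) eq = inj₂ (shift-invariant⇒constant false q eq)

rising-and-falling : ∀ {d} → Linked _<_ d → Linked _>_ d → 2 ≤ length d → ⊥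
rising-and-falling (x<y ∷ _) (x>y ∷ _) _ = <-asym x<y x>y
rising-and-falling [-]       [-]       (s≤s ())

data Shape (d : List ℕ) : Set where
  rising  : Linked _<_ d → Shape d
  falling : ¬ Linked _<_ d → Linked _>_ d → Shape d
  zigzag  : ¬ Linked _<_ d → ¬ Linked _>_ d → Shape d

shape : (d : List ℕ) → Shape d
shape d with linked? _<?_ d | linked? _>?_ d
... | yes up  | _        = rising up
... | no ¬up  | yes down = falling ¬up down
... | no ¬up  | no ¬down = zigzag ¬up ¬down

data Kind : Set where
  rising falling zigzag : Kind

kind : ∀ {d} → Shape d → Kind
kind (rising _)    = rising
kind (falling _ _) = falling
kind (zigzag _ _)  = zigzag

module SteppingUp (F K : ℕ) (φ : List ℕ → ℕ) where

  -- Reflection of {0, …, F-1}; it turns decreasing lists into increasing ones.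
  mirror : ℕ → ℕ
  mirror a = F ∸ suc a

  mirror-edge : ∀ {n d} → Linked _>_ d → All (_< F) d → length d ≡ n → Edge F n (map mirror d)
  mirror-edge {d = d} down bnd size = edge (increasing down bnd) (trans (length-map mirror d) size) (bounded bnd)
    where
    increasing : ∀ {d} → Linked _>_ d → All (_< F) d → Linked _<_ (map mirror d)
    increasing []           _            = []
    increasing [-]          _            = [-]
    increasing (x>y ∷ down) (x<F ∷ bnd) = ∸-monoʳ-< (s≤s x>y) x<F ∷ increasing down bnd
    bounded : ∀ {d} → All (_< F) d → All (_< F) (map mirror d)
    bounded []          = []
    bounded (a<F ∷ bnd) = ∸-monoʳ-< (s≤s z≤n) a<F ∷ bounded bnd

  colourOf : (d : List ℕ) → Shape d → ℕ
  colourOf d (rising _)    = φ d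
  colourOf d (falling _ _) = K + φ (map mirror d)
  colourOf d (zigzag _ _)  = 2 * K + code (upDown d)

  stepUp : List ℕ → ℕ
  stepUp xs = colourOf (δs F xs) (shape (δs F xs))

  colourOf-rising : ∀ {d} → Linked _<_ d → (v : Shape d) → colourOf d v ≡ φ d
  colourOf-rising up (rising _)     = refl
  colourOf-rising up (falling ¬up _) = ⊥-elim (¬up up)
  colourOf-rising up (zigzag ¬up _)  = ⊥-elim (¬up up)

  colourOf-falling : ∀ {d} → Linked _>_ d → 2 ≤ length d → (v : Shape d) → colourOf d v ≡ K + φ (map mirror d)
  colourOf-falling down len (rising up)      = ⊥-elim (rising-and-falling up down len)
  colourOf-falling down len (falling _ _)    = refl
  colourOf-falling down len (zigzag _ ¬down) = ⊥-elim (¬down down)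

  band : ℕ → Kind
  band c with c <? K | c <? 2 * K
  ... | yes _ | _     = rising
  ... | no _  | yes _ = falling
  ... | no _  | no _  = zigzag

  band-rising : ∀ {c} → c < K → band c ≡ rising
  band-rising {c} c<K with c <? K
  ... | yes _  = refl
  ... | no c≮K = ⊥-elim (c≮K c<K)

  band-falling : ∀ {c} → K ≤ c → c < 2 * K → band c ≡ falling
  band-falling {c} K≤c c<2K with c <? K | c <? 2 * K
  ... | yes c<K | _       = ⊥-elim (<⇒≱ c<K K≤c)
  ... | no _    | yes _   = refl
  ... | no _    | no c≮2K = ⊥-elim (c≮2K c<2K)

  band-zigzag : ∀ {c} → 2 * K ≤ c → band c ≡ zigzag
  band-zigzag {c} 2K≤c with c <? K | c <? 2 * K
  ... | yes c<K  | _        = ⊥-elim (<⇒≱ c<K (≤-trans (m≤m+n K _) 2K≤c))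
  ... | no _     | yes c<2K = ⊥-elim (<⇒≱ c<2K 2K≤c)
  ... | no _     | no _     = refl

  module _ {n : ℕ} (φ-bounded : Bounded K F n φ) {d : List ℕ} (bnd : All (_< F) d) (size : length d ≡ n) where

    falling-colour< : Linked _>_ d → K + φ (map mirror d) < 2 * K
    falling-colour< down = subst (K + φ (map mirror d) <_) (cong (K +_) (sym (+-identityʳ K)))
                                 (+-monoʳ-< K (φ-bounded (mirror-edge down bnd size)))

    colourOf-band : (v : Shape d) → band (colourOf d v) ≡ kind v
    colourOf-band (rising up)     = band-rising (φ-bounded (edge up size bnd))
    colourOf-band (falling _ down) = band-falling (m≤m+n K _) (falling-colour< down)
    colourOf-band (zigzag _ _)     = band-zigzag (m≤m+n (2 * K) _)

    colourOf-bound : (v : Shape d) → colourOf d v < 2 * K + 2 ^ (n ∸ 1)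
    colourOf-bound (rising up)      = <-≤-trans (φ-bounded (edge up size bnd)) (≤-trans (m≤m+n K _) (m≤m+n (2 * K) _))
    colourOf-bound (falling _ down) = <-≤-trans (falling-colour< down) (m≤m+n (2 * K) _)
    colourOf-bound (zigzag _ _)     = +-monoʳ-< (2 * K)
      (subst (λ l → code (upDown d) < 2 ^ l) (trans (length-adjacent _<ᵇ_ d) (cong (_∸ 1) size)) (code-bound (upDown d)))

  stepUp-bounded : ∀ {n} → Bounded K F n φ → Bounded (2 * K + 2 ^ (n ∸ 1)) (2 ^ F) (suc n) stepUp
  stepUp-bounded φ-bounded {xs} (edge inc size bnd) =
    colourOf-bound φ-bounded (δs-bounded F inc bnd) (length-δs F xs size) (shape (δs F xs))

  -- Suppose all
  -- one-entry deletions of an increasing list xs get colour c, and compare the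
  -- deletions of its first and of its last entry.
  module _ {n : ℕ} (φ-bounded : Bounded K F (suc (suc n)) φ) (φ-noMono : NoMonochromatic F (suc (suc n)) φ)
           {xs : List ℕ} (e : Edge (2 ^ F) (suc (suc (suc (suc n)))) xs) (c : ℕ)
           (mono : ∀ i → i ≤ suc (suc (suc n)) → stepUp (deleteAt i xs) ≡ c) where

    open Edge e
    open ≡-Reasoning

    d d₀ dₗ : List ℕ
    d  = δs F xs
    d₀ = δs F (deleteAt 0 xs)
    dₗ = δs F (deleteAt (suc (suc (suc n))) xs)

    d₀≡ : d₀ ≡ deleteAt 0 d
    d₀≡ = adjacent-deleteHead (δ F) xs

    dₗ≡ : dₗ ≡ dropLast d
    dₗ≡ = trans (cong (δs F) (deleteAt-last _ xs size)) (adjacent-dropLast (δ F) xs)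

    deletion-bounded : ∀ i → i ≤ suc (suc (suc n)) → All (_< F) (δs F (deleteAt i xs))
    deletion-bounded i i≤ = let edge inc′ _ bnd′ = edge-deleteAt e i i≤ in δs-bounded F inc′ bnd′

    deletion-size : ∀ i → i ≤ suc (suc (suc n)) → length (δs F (deleteAt i xs)) ≡ suc (suc n)
    deletion-size i i≤ = length-δs F (deleteAt i xs) (Edge.size (edge-deleteAt e i i≤))

    -- Deletions of the first and last entry have the same colour, so their
    -- branching digits have the same shape.
    same-kind : kind (shape d₀) ≡ kind (shape dₗ)
    same-kind = trans (sym (kind-of 0 z≤n)) (kind-of _ ≤-refl)
      where
      kind-of : ∀ i (i≤ : i ≤ suc (suc (suc n))) → band c ≡ kind (shape (δs F (deleteAt i xs)))
      kind-of i i≤ = trans (cong band (sym (mono i i≤)))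
                           (colourOf-band φ-bounded (deletion-bounded i i≤) (deletion-size i i≤) (shape _))

    d-bounded : All (_< F) d
    d-bounded = δs-bounded F increasing bounded

    d-size : length d ≡ suc (suc (suc n))
    d-size = length-δs F xs size

    -- Both increase: then d increases, deleting x_{j+1} deletes δ_j, and φ would
    -- be constant on the deletions from d.
    rising-case : Linked _<_ d₀ → Linked _<_ dₗ → ⊥
    rising-case up₀ upₗ = φ-noMono (edge up d-size d-bounded) c λ j j≤ →
      let eq = δs-deleteAt-rising F j xs increasing bounded up in
      begin
        φ (deleteAt j d)                  ≡⟨ cong φ eq ⟨
        φ (δs F (deleteAt (suc j) xs))    ≡⟨ colourOf-rising (subst (Linked _<_) (sym eq) (Linked-deleteAt <-trans j up)) (shape _) ⟨
        stepUp (deleteAt (suc j) xs)      ≡⟨ mono (suc j) (s≤s j≤) ⟩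
        c                                 ∎
      where
      up : Linked _<_ d
      up = Linked-join d (subst (3 ≤_) (sym d-size) (s≤s (s≤s (s≤s z≤n))))
                       (subst (Linked _<_) d₀≡ up₀) (subst (Linked _<_) dₗ≡ upₗ)

    -- Both decrease: then d decreases, deleting x_j deletes δ_j, and φ would be
    -- constant on the deletions from the mirror image of d.
    falling-case : Linked _>_ d₀ → Linked _>_ dₗ → ⊥
    falling-case down₀ downₗ = φ-noMono (mirror-edge down d-bounded d-size) (c ∸ K) λ j j≤ →
      let eq = δs-deleteAt-falling F j xs (subst (suc j <_) (sym size) (s≤s (s≤s j≤))) increasing bounded down
          down′ = subst (Linked _>_) (sym eq) (Linked-deleteAt (λ x>y y>z → <-trans y>z x>y) j down)
          size′ = subst (2 ≤_) (sym (deletion-size j (m≤n⇒m≤1+n j≤))) (s≤s (s≤s z≤n))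
      in begin
        φ (deleteAt j (map mirror d))           ≡⟨ cong φ (deleteAt-map mirror j d) ⟩
        φ (map mirror (deleteAt j d))           ≡⟨ cong (λ l → φ (map mirror l)) eq ⟨
        φ (map mirror (δs F (deleteAt j xs)))   ≡⟨ m+n∸m≡n K _ ⟨
        K + φ (map mirror (δs F (deleteAt j xs))) ∸ K ≡⟨ cong (_∸ K) (colourOf-falling down′ size′ (shape _)) ⟨
        stepUp (deleteAt j xs) ∸ K              ≡⟨ cong (_∸ K) (mono j (m≤n⇒m≤1+n j≤)) ⟩
        c ∸ K                                   ∎
      where
      down : Linked _>_ d
      down = Linked-join d (subst (3 ≤_) (sym d-size) (s≤s (s≤s (s≤s z≤n))))
                         (subst (Linked _>_) d₀≡ down₀) (subst (Linked _>_) dₗ≡ downₗ)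

    pattern-size : ∀ i → i ≤ suc (suc (suc n)) → length (upDown (δs F (deleteAt i xs))) ≡ suc n
    pattern-size i i≤ = trans (length-adjacent _<ᵇ_ (δs F (deleteAt i xs))) (cong (_∸ 1) (deletion-size i i≤))

    pattern₀ : upDown d₀ ≡ deleteAt 0 (upDown d)
    pattern₀ = trans (cong upDown d₀≡) (adjacent-deleteHead _<ᵇ_ d)

    patternₗ : upDown dₗ ≡ dropLast (upDown d)
    patternₗ = trans (cong upDown dₗ≡) (adjacent-dropLast _<ᵇ_ d)

    distinct₀ : Linked _≢_ d₀
    distinct₀ = let edge inc₀ _ bnd₀ = edge-deleteAt e 0 z≤n in δs-distinct F inc₀ bnd₀

    -- Neither is monotone: equal codes mean equal up/down patterns, so the pattern
    -- of d is shift invariant; then d₀ would be monotone after all.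
    pattern-shift-invariant : code (upDown d₀) ≡ code (upDown dₗ) → deleteAt 0 (upDown d) ≡ dropLast (upDown d)
    pattern-shift-invariant same-code = begin
      deleteAt 0 (upDown d)  ≡⟨ pattern₀ ⟨
      upDown d₀              ≡⟨ code-injective _ _ (trans (pattern-size 0 z≤n) (sym (pattern-size _ ≤-refl))) same-code ⟩
      upDown dₗ              ≡⟨ patternₗ ⟩
      dropLast (upDown d)    ∎

    zigzag-case : ¬ Linked _<_ d₀ → ¬ Linked _>_ d₀ → code (upDown d₀) ≡ code (upDown dₗ) → ⊥
    zigzag-case ¬up₀ ¬down₀ same-code with shift-invariant-bits (upDown d) (pattern-shift-invariant same-code)
    ... | inj₁ ups   = ¬up₀ (rising-pattern d₀ (subst (All (_≡ true)) (sym pattern₀) ups))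
    ... | inj₂ downs = ¬down₀ (falling-pattern d₀ (subst (All (_≡ false)) (sym pattern₀) downs) distinct₀)

    split : (v₀ : Shape d₀) (vₗ : Shape dₗ) → kind v₀ ≡ kind vₗ → colourOf d₀ v₀ ≡ c → colourOf dₗ vₗ ≡ c → ⊥
    split (rising up₀)         (rising upₗ)       _  _  _  = rising-case up₀ upₗ
    split (falling _ down₀)    (falling _ downₗ)  _  _  _  = falling-case down₀ downₗ
    split (zigzag ¬up₀ ¬down₀) (zigzag _ _)       _  c₀ cₗ = zigzag-case ¬up₀ ¬down₀ (+-cancelˡ-≡ (2 * K) _ _ (trans c₀ (sym cₗ)))
    split (rising _)           (falling _ _)      ()
    split (rising _)           (zigzag _ _)       ()
    split (falling _ _)        (rising _)         ()
    split (falling _ _)        (zigzag _ _)       ()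
    split (zigzag _ _)         (rising _)         ()
    split (zigzag _ _)         (falling _ _)      ()

    no-monochromatic-clique : ⊥
    no-monochromatic-clique = split (shape d₀) (shape dₗ) same-kind (mono 0 z≤n) (mono _ ≤-refl)

  stepUp-noMonochromatic : ∀ {n} → Bounded K F (suc (suc n)) φ → NoMonochromatic F (suc (suc n)) φ →
                           NoMonochromatic (2 ^ F) (suc (suc (suc n))) stepUp
  stepUp-noMonochromatic φ-bounded φ-noMono e c mono = no-monochromatic-clique φ-bounded φ-noMono e c mono

-- t_{ℓ+1}(m), the tower of height ℓ + 1 with m on top.
tower : ℕ → ℕ → ℕ
tower m zero    = m
tower m (suc ℓ) = 2 ^ tower m ℓ

colours : ℕ → ℕ → ℕ
colours m zero    = m
colours m (suc ℓ) = 2 * colours m ℓ + 2 ^ ℓ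

vertexColour : List ℕ → ℕ
vertexColour []      = 0
vertexColour (x ∷ _) = x

colouring : ℕ → ℕ → List ℕ → ℕ
colouring m zero    = vertexColour
colouring m (suc ℓ) = SteppingUp.stepUp (tower m ℓ) (colours m ℓ) (colouring m ℓ)

colouring-bounded : ∀ m ℓ → Bounded (colours m ℓ) (tower m ℓ) (suc ℓ) (colouring m ℓ)
colouring-bounded m zero    {x ∷ []}     (edge _ _ (x<m ∷ [])) = x<m
colouring-bounded m zero    {[]}         (edge _ () _)
colouring-bounded m zero    {x ∷ y ∷ xs} (edge _ () _)
colouring-bounded m (suc ℓ) = SteppingUp.stepUp-bounded (tower m ℓ) (colours m ℓ) (colouring m ℓ) (colouring-bounded m ℓ)

-- Levels 0 and 1 directly (distinct vertices; δ-distinct), higher levels by stepping up.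
colouring-noMonochromatic : ∀ m ℓ → NoMonochromatic (tower m ℓ) (suc ℓ) (colouring m ℓ)
colouring-noMonochromatic m zero {x ∷ y ∷ []} (edge (x<y ∷ _) _ _) c mono =
  <⇒≢ x<y (trans (mono 1 (s≤s z≤n)) (sym (mono 0 z≤n)))
colouring-noMonochromatic m (suc zero) {x ∷ y ∷ z ∷ []} (edge (x<y ∷ y<z ∷ _) _ (_ ∷ _ ∷ z<2^m ∷ [])) c mono =
  δ-distinct m x<y y<z z<2^m (trans (mono 2 (s≤s (s≤s z≤n))) (sym (mono 0 z≤n)))
colouring-noMonochromatic m (suc (suc ℓ)) =
  SteppingUp.stepUp-noMonochromatic (tower m (suc ℓ)) (colours m (suc ℓ)) (colouring m (suc ℓ))
    (colouring-bounded m (suc ℓ)) (colouring-noMonochromatic m (suc ℓ))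

colours-bound : ∀ m ℓ → colours m ℓ ≤ 2 ^ ℓ * (m + ℓ)
colours-bound m zero    = ≤-reflexive (sym (trans (+-identityʳ (m + 0)) (+-identityʳ m)))
colours-bound m (suc ℓ) = begin
  2 * colours m ℓ + 2 ^ ℓ               ≤⟨ +-monoˡ-≤ (2 ^ ℓ) (*-monoʳ-≤ 2 (colours-bound m ℓ)) ⟩
  2 * (2 ^ ℓ * (m + ℓ)) + 2 ^ ℓ         ≤⟨ m≤m+n _ (2 ^ ℓ) ⟩
  2 * (2 ^ ℓ * (m + ℓ)) + 2 ^ ℓ + 2 ^ ℓ ≡⟨ regroup (2 ^ ℓ) m ℓ ⟩
  2 ^ suc ℓ * (m + suc ℓ)               ∎
  where
  open ≤-Reasoning
  regroup : ∀ P m ℓ → 2 * (P * (m + ℓ)) + P + P ≡ 2 * P * (m + suc ℓ)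
  regroup = solve-∀

colours-at-most : ∀ ℓ q → suc ℓ ≤ q → colours (suc q) ℓ ≤ 2 ^ suc ℓ * q
colours-at-most ℓ q r≤q = begin
  colours (suc q) ℓ         ≤⟨ colours-bound (suc q) ℓ ⟩
  2 ^ ℓ * (suc q + ℓ)       ≡⟨ cong (2 ^ ℓ *_) (+-suc q ℓ) ⟨
  2 ^ ℓ * (q + suc ℓ)       ≤⟨ *-monoʳ-≤ (2 ^ ℓ) (+-monoʳ-≤ q r≤q) ⟩
  2 ^ ℓ * (q + q)           ≡⟨ double (2 ^ ℓ) q ⟩
  2 ^ suc ℓ * q             ∎
  where
  open ≤-Reasoning
  double : ∀ P q → P * (q + q) ≡ 2 * P * q
  double = solve-∀

ceiling-quotient : ∀ b k′ .{{_ : NonZero b}} → ∃[ q ] (b * q < suc k′ × suc k′ ≤ b * suc q)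
ceiling-quotient b k′ = k′ / b , s≤s (≤-trans (≤-reflexive (*-comm b (k′ / b))) (m/n*n≤m k′ b)) , (begin-strict
  k′                    ≡⟨ m≡m%n+[m/n]*n k′ b ⟩
  k′ % b + k′ / b * b   <⟨ +-monoˡ-< (k′ / b * b) (m%n<n k′ b) ⟩
  b + k′ / b * b        ≡⟨ cong (b +_) (*-comm (k′ / b) b) ⟩
  b + b * (k′ / b)      ≡⟨ *-suc b (k′ / b) ⟨
  b * suc (k′ / b)      ∎)
  where open ≤-Reasoning

-- If c/d < 2^(e/f) and e ≤ T f, then c/d < 2^T: otherwise (d 2^T)^f ≤ c^f < 2^e d^f.
power-comparison : ∀ {c d e f} T → e ≤ T * f → d * 2 ^ T ≤ c → 2 ^ e * d ^ f ≤ c ^ f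
power-comparison {c} {d} {e} {f} T e≤Tf d·2^T≤c = begin
  2 ^ e * d ^ f           ≤⟨ *-monoˡ-≤ (d ^ f) (^-monoʳ-≤ 2 e≤Tf) ⟩
  2 ^ (T * f) * d ^ f     ≡⟨ cong (_* d ^ f) (^-*-assoc 2 T f) ⟨
  (2 ^ T) ^ f * d ^ f     ≡⟨ *-comm ((2 ^ T) ^ f) (d ^ f) ⟩
  d ^ f * (2 ^ T) ^ f     ≡⟨ ^-distribʳ-* d (2 ^ T) f ⟨
  (d * 2 ^ T) ^ f         ≤⟨ ^-monoˡ-≤ f d·2^T≤c ⟩
  c ^ f                   ∎
  where
  open ≤-Reasoning
  ^-distribʳ-* : ∀ x y f → (x * y) ^ f ≡ x ^ f * y ^ f
  ^-distribʳ-* x y zero    = refl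
  ^-distribʳ-* x y (suc f) = trans (cong (x * y *_) (^-distribʳ-* x y f)) (interchange x y (x ^ f) (y ^ f))
    where
    interchange : ∀ a b c d → a * b * (c * d) ≡ a * c * (b * d)
    interchange = solve-∀

below-tower : ∀ m i {a b c d} → a ≤ b * m → RatBelowTower i a b c d → c < d * tower m i
below-tower m zero {a} {b} {c} {d} a≤bm c·b<a·d = *-cancelʳ-< b c (d * m) (begin-strict
  c * b        <⟨ c·b<a·d ⟩
  a * d        ≤⟨ *-monoˡ-≤ d a≤bm ⟩
  b * m * d    ≡⟨ swap b m d ⟩
  d * m * b    ∎)
  where
  open ≤-Reasoning
  swap : ∀ b m d → b * m * d ≡ d * m * b
  swap = solve-∀
below-tower m (suc i) {c = c} {d} a≤bm (e , f , _ , c^f<2^e·d^f , e/f<t) with c <? d * tower m (suc i)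
... | yes c<d·t = c<d·t
... | no  c≮d·t = ⊥-elim (<⇒≱ c^f<2^e·d^f (power-comparison (tower m i) e≤Tf (≮⇒≥ c≮d·t)))
  where
  e≤Tf : e ≤ tower m i * f
  e≤Tf = subst (e ≤_) (*-comm f (tower m i)) (<⇒≤ (below-tower m i a≤bm e/f<t))

tower-upper-bound : ∀ m L {k b} N → k ≤ b * m → NatLeTower (suc L) k b N → N ≤ tower m L
tower-upper-bound m L zero    _    _    = z≤n
tower-upper-bound m L (suc n) k≤bm N≤t = subst (suc n ≤_) (*-identityˡ (tower m L))
  (below-tower m L k≤bm (N≤t n 1 ≤-refl (subst (n <_) (sym (*-identityʳ (suc n))) ≤-refl)))

elements : ∀ {n} → Subset n → List ℕ
elements []            = []
elements (inside ∷ p)  = 0 ∷ map suc (elements p)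
elements (outside ∷ p) = map suc (elements p)

length-elements : ∀ {n} (p : Subset n) → length (elements p) ≡ ∣ p ∣
length-elements []            = refl
length-elements (inside ∷ p)  = cong suc (trans (length-map suc (elements p)) (length-elements p))
length-elements (outside ∷ p) = trans (length-map suc (elements p)) (length-elements p)

elements-increasing : ∀ {n} (p : Subset n) → Linked _<_ (elements p)
elements-increasing []            = []
elements-increasing (outside ∷ p) = Linked-map⁺ (Linked.map s≤s (elements-increasing p))
elements-increasing (inside ∷ p)  = prepend-zero (elements p) (elements-increasing p)
  where
  prepend-zero : ∀ xs → Linked _<_ xs → Linked _<_ (0 ∷ map suc xs)
  prepend-zero []       _   = [-]
  prepend-zero (x ∷ xs) inc = z<s ∷ Linked-map⁺ (Linked.map s≤s inc)

elements-bounded : ∀ {n} (p : Subset n) → All (_< n) (elements p)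
elements-bounded []            = []
elements-bounded (inside ∷ p)  = z<s ∷ All-map⁺ (All.map s≤s (elements-bounded p))
elements-bounded (outside ∷ p) = All-map⁺ (All.map s≤s (elements-bounded p))

elements-edge : ∀ {n F} (p : Subset n) → n ≤ F → Edge F ∣ p ∣ (elements p)
elements-edge p n≤F = edge (elements-increasing p) (length-elements p)
                           (All.map (λ x<n → <-≤-trans x<n n≤F) (elements-bounded p))

keep : ∀ {n} → ℕ → Subset n → Subset n
keep k       []            = []
keep k       (outside ∷ p) = outside ∷ keep k p
keep zero    (inside ∷ p)  = outside ∷ keep zero p
keep (suc k) (inside ∷ p)  = inside ∷ keep k p

keep-⊆ : ∀ {n} k (p : Subset n) → keep k p ⊆ p
keep-⊆ k       []            ()
keep-⊆ k       (outside ∷ p) = out⊆ (keep-⊆ k p)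
keep-⊆ zero    (inside ∷ p)  = out⊆ (keep-⊆ zero p)
keep-⊆ (suc k) (inside ∷ p)  = s⊆s (keep-⊆ k p)

card-keep : ∀ {n} k (p : Subset n) → k ≤ ∣ p ∣ → ∣ keep k p ∣ ≡ k
card-keep zero    []            _         = refl
card-keep k       (outside ∷ p) k≤∣p∣       = card-keep k p k≤∣p∣
card-keep zero    (inside ∷ p)  _         = card-keep zero p z≤n
card-keep (suc k) (inside ∷ p)  (s≤s k≤∣p∣) = cong suc (card-keep k p k≤∣p∣)

remove : ∀ {n} → ℕ → Subset n → Subset n
remove i       []            = []
remove i       (outside ∷ p) = outside ∷ remove i p
remove zero    (inside ∷ p)  = outside ∷ p
remove (suc i) (inside ∷ p)  = inside ∷ remove i p

remove-⊆ : ∀ {n} i (p : Subset n) → remove i p ⊆ p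
remove-⊆ i       []            ()
remove-⊆ i       (outside ∷ p) = out⊆ (remove-⊆ i p)
remove-⊆ zero    (inside ∷ p)  = out⊆ ⊆-refl
remove-⊆ (suc i) (inside ∷ p)  = s⊆s (remove-⊆ i p)

elements-remove : ∀ {n} i (p : Subset n) → elements (remove i p) ≡ deleteAt i (elements p)
elements-remove i       []            = refl
elements-remove i       (outside ∷ p) = shifted i p
  where
  shifted : ∀ {n} i (p : Subset n) → map suc (elements (remove i p)) ≡ deleteAt i (map suc (elements p))
  shifted i p = trans (cong (map suc) (elements-remove i p)) (sym (deleteAt-map suc i (elements p)))
elements-remove zero    (inside ∷ p)  = refl
elements-remove (suc i) (inside ∷ p)  =
  cong (0 ∷_) (trans (cong (map suc) (elements-remove i p)) (sym (deleteAt-map suc i (elements p))))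

-- A number read as one of the colours Fin (suc k); numbers out of range become 0.
asColour : ∀ k → ℕ → Fin (suc k)
asColour k v with v <? suc k
... | yes v<k = fromℕ< v<k
... | no _    = Fin.zero

toℕ-asColour : ∀ {k v} → v < suc k → toℕ (asColour k v) ≡ v
toℕ-asColour {k} {v} v<k with v <? suc k
... | yes v<k′ = toℕ-fromℕ< v<k′
... | no v≮k   = ⊥-elim (v≮k v<k)

asColour-injective : ∀ {k v w} → v < suc k → w < suc k → asColour k v ≡ asColour k w → v ≡ w
asColour-injective v<k w<k eq = trans (sym (toℕ-asColour v<k)) (trans (cong toℕ eq) (toℕ-asColour w<k))

-- A colouring of the r-subsets of {0, …, F-1} with at most k colours and no
-- monochromatic K_{r+1}^r shows K_N^r ↛ (K_s^r)_k for every N ≤ F and s > r: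
-- colour an edge e by the colour of its element list, take the first r+1
-- vertices of a monochromatic K_s^r and delete one of them at a time.
no-arrow : ∀ {F K r s} k′ {φ : List ℕ → ℕ} N → N ≤ F → K ≤ suc k′ → r < s →
           Bounded K F r φ → NoMonochromatic F r φ → ¬ Arrows N (suc k′) r s
no-arrow {F} {K} {r} k′ {φ} N N≤F K≤k r<s φ-bounded φ-noMono arrows
  with arrows (λ e → asColour k′ (φ (elements e)))
... | S , c , ∣S∣≡s , mono =
  φ-noMono xs-edge (φ (deleteAt 0 xs)) λ i i≤r →
    asColour-injective (colour< i i≤r) (colour< 0 z≤n) (trans (deletion-colour i i≤r) (sym (deletion-colour 0 z≤n)))
  where
  S′ : Subset N
  S′ = keep (suc r) S
  xs : List ℕ
  xs = elements S′
  xs-edge : Edge F (suc r) xs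
  xs-edge = subst (λ n → Edge F n xs) (card-keep (suc r) S (subst (suc r ≤_) (sym ∣S∣≡s) r<s)) (elements-edge S′ N≤F)
  colour< : ∀ i → i ≤ r → φ (deleteAt i xs) < suc k′
  colour< i i≤r = <-≤-trans (φ-bounded (edge-deleteAt xs-edge i i≤r)) K≤k
  deletion-colour : ∀ i → i ≤ r → asColour k′ (φ (deleteAt i xs)) ≡ c
  deletion-colour i i≤r = subst (λ l → asColour k′ (φ l) ≡ c) (elements-remove i S′)
    (mono (remove i S′) (⊆-trans (remove-⊆ i S′) (keep-⊆ (suc r) S)) (begin
      ∣ remove i S′ ∣                 ≡⟨ length-elements (remove i S′) ⟨
      length (elements (remove i S′)) ≡⟨ cong length (elements-remove i S′) ⟩
      length (deleteAt i xs)         ≡⟨ Edge.size (edge-deleteAt xs-edge i i≤r) ⟩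
      r                              ∎))
    where open ≡-Reasoning

mainTheorem2 : ∀ (r s k : ℕ) → 2 ≤ r → r < s → r * 2 ^ r < k →
    ∀ (N : ℕ) → NatLeTower r k (2 ^ r) N → ¬ Arrows N k r s
mainTheorem2 (suc ℓ) s (suc k′) _ r<s r·2^r<k N N≤t =
  no-arrow k′ N (tower-upper-bound m ℓ N k≤b·m N≤t) colours≤k r<s
           (colouring-bounded m ℓ) (colouring-noMonochromatic m ℓ)
  where
  b : ℕ
  b = 2 ^ suc ℓ
  bracket : ∃[ q ] (b * q < suc k′ × suc k′ ≤ b * suc q)
  bracket = ceiling-quotient b k′ {{m^n≢0 2 (suc ℓ)}}
  q m : ℕ
  q = proj₁ bracket
  m = suc q
  k≤b·m : suc k′ ≤ b * m
  k≤b·m = proj₂ (proj₂ bracket)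
  r≤q : suc ℓ ≤ q
  r≤q = ≤-pred (*-cancelʳ-< b (suc ℓ) m (<-≤-trans r·2^r<k (subst (suc k′ ≤_) (*-comm b m) k≤b·m)))
  colours≤k : colours m ℓ ≤ suc k′
  colours≤k = ≤-trans (colours-at-most ℓ q r≤q) (<⇒≤ (proj₁ (proj₂ bracket)))
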